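{- If $x\sim^m y$ then $x\mathrel{\underline{\leftrightarrow}}^m_\ast y$.
   Context: $|n|_K$ denotes the element of $\{1,\dots,K\}$ congruent to $n$ mod $K$. $\mathfrak B=\mathfrak B(N,K)$ is the model (finite preorder with downset topology, plus a function $f_\mathfrak B$) whose points are triples $(h,t,k)$ of natural numbers with either ($h+t\le NK$, $k\in[1,K]$, $k\not\equiv h+t \pmod K$) or ($h=0$, $t\in[NK+1,N(K+1)]$, $k\neq K$); $(h_1,t_1,k_1)\preccurlyeq(h_2,t_2,k_2)$ iff $t_1=t_2$ and $h_1\ge h_2$; $f_\mathfrak B(h,t,k)$ is $(h,t+1,|k+1|_K)$ if $h+t<NK$, $(h-1,t+1,k)$ if $h+t=NK$ and $h>0$, $(h,t+1,k)$ if $t\in[NK+1,N(K+1))$, and $(0,0,|k+1|_K)$ if $t=N(K+1)$; the point $(h,t,k)$ satisfies exactly $p_k$ (write $p(x)$). For $x=(h,t,k)$ put $s(x)=h+t$. For $m<N$, $x\sim^m y$ means $p(x)=p(y)$ and at least one of: $s(x)=s(y)$; $s(x),s(y)\le K(N-m)$; $s(x),s(y)\in[NK,N(K+1)-m]$. $\mathrel{\underline{\leftrightarrow}}^m_\ast$ is tangled partial bisimulation with unbounded cluster size: $x\mathrel{\underline{\leftrightarrow}}^0_\ast y$ iff same atoms; $x\mathrel{\underline{\leftrightarrow}}^{m+1}_\ast y$ iff same atoms and (Forth/Back$_\preccurlyeq$) for every finite $x_1\approx\dots\approx x_j\preccurlyeq x$ there are $y_1\approx\dots\approx y_j\preccurlyeq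 y$ with $x_i\mathrel{\underline{\leftrightarrow}}^m_\ast y_i$ and conversely; (Forth$_f$) $f(x)\mathrel{\underline{\leftrightarrow}}^m_\ast f(y)$; (Forth/Back$_{[f]}$) for every $n$ there is $n'$ with $f^n(x)\mathrel{\underline{\leftrightarrow}}^m_\ast f^{n'}(y)$ and conversely. -}

module Defs where

open import Data.Nat using (ℕ; zero; suc; _+_; _*_; _∸_; _≤_; _<_; NonZero; _<ᵇ_; _≡ᵇ_)
open import Data.Nat.DivMod using (_%_)
open import Data.Bool using (Bool; true; false; if_then_else_; _∧_)
open import Data.Product using (_×_; ∃)
open import Data.Sum using (_⊎_)
open import Data.List using (List)
open import Data.List.Relation.Unary.All using (All)
open import Data.List.Relation.Unary.AllPairs using (AllPairs)
open import Data.List.Relation.Binary.Pointwise using (Pointwise)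
open import Relation.Binary.PropositionalEquality using (_≡_; _≢_)

record Triple : Set where
  constructor ⟨_,_,_⟩
  field
    h : ℕ
    t : ℕ
    k : ℕ
open Triple public

s : Triple → ℕ
s x = h x + t x

-- the atom satisfied by x is p_k; we record its index
p : Triple → ℕ
p x = k x

iter : (Triple → Triple) → ℕ → Triple → Triple
iter g zero x = x
iter g (suc n) x = g (iter g n x)

module Model (N K : ℕ) .{{_ : NonZero K}} where

  -- |n|_K : the element of {1,…,K} congruent to n mod K
  ∣_∣K : ℕ → ℕ
  ∣ n ∣K = suc ((n + K ∸ 1) % K)

  In : Triple → Set
  In x = (s x ≤ N * K × 1 ≤ k x × k x ≤ K × k x % K ≢ s x % K)
       ⊎ (h x ≡ 0 × suc (N * K) ≤ t x × t x ≤ N * (K + 1) × 1 ≤ k x × k x ≤ K × k x ≢ K)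

  _≼_ : Triple → Triple → Set
  x ≼ y = t x ≡ t y × h y ≤ h x

  _≈_ : Triple → Triple → Set
  x ≈ y = x ≼ y × y ≼ x

  f : Triple → Triple
  f ⟨ h , t , k ⟩ =
    if (h + t) <ᵇ (N * K) then ⟨ h , suc t , ∣ suc k ∣K ⟩
    else if ((h + t) ≡ᵇ (N * K)) ∧ (0 <ᵇ h) then ⟨ h ∸ 1 , suc t , k ⟩
    else if t <ᵇ (N * (K + 1)) then ⟨ h , suc t , k ⟩
    else ⟨ 0 , 0 , ∣ suc k ∣K ⟩

  Sim : ℕ → Triple → Triple → Set
  Sim m x y = p x ≡ p y ×
    ( s x ≡ s y
    ⊎ (s x ≤ K * (N ∸ m) × s y ≤ K * (N ∸ m))
    ⊎ ((N * K ≤ s x × s x ≤ N * (K + 1) ∸ m) × (N * K ≤ s y × s y ≤ N * (K + 1) ∸ m)))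

  -- tangled partial bisimulation with unbounded cluster size
  Bisim : ℕ → Triple → Triple → Set
  Bisim zero x y = p x ≡ p y
  Bisim (suc m) x y =
    p x ≡ p y × Forth≼ x y × Forth≼ y x × Bisim m (f x) (f y) × Forth[f] x y × Forth[f] y x
    where
      Forth≼ : Triple → Triple → Set
      Forth≼ a b = (as : List Triple) → All In as → AllPairs _≈_ as → All (_≼ a) as →
        ∃ λ (bs : List Triple) → All In bs × AllPairs _≈_ bs × All (_≼ b) bs
          × Pointwise (Bisim m) as bs
      Forth[f] : Triple → Triple → Set
      Forth[f] a b = (n : ℕ) → ∃ λ (n′ : ℕ) → Bisim m (iter f n a) (iter f n′ b)

module Submission where

-- Write K = suc K′, NK = N·K and NK₁ = N·(K+1).  The points of 𝔅 form a "triangle"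
-- (h + t ≤ NK, atom k ≢ h + t mod K) and a "tail" (h = 0, NK < t ≤ NK₁, k ≠ K); the
-- "spine" consists of the triples ⟨0,t,k⟩ with t ≤ NK₁.  The proof is by induction on m,
-- treating the clauses of ↔^{m+1}_∗ separately:
--   * Forth/Back≼: a cluster below x consists of points sharing h and t; each of its
--     points a is sent to ⟨G (s a), t y, k a⟩ for a height function G chosen according
--     to the clause of ∼^{m+1} that holds (a "matching"), so that a ∼^m its image;
--   * Forth_f: one step of f moves a point up by at most one tier, so f x = f y or
--     f x ∼^m f y;
--   * Forth/Back_[f]: the orbit of every point reaches every spine point, and every orbit
--     point lies on the spine or in the triangle, where it is ∼^m-related to the spine
--     point with the same sum and atom.

open import Defs
open import Data.Nat using (ℕ; _<_; NonZero)
open import Data.Nat using (zero; suc; _+_; _*_; _∸_; _≤_; z≤n; s≤s; _<ᵇ_; _≡ᵇ_; _≤?_; _<?_)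
open import Data.Nat.Properties
open import Data.Nat.DivMod using (_%_; %-distribˡ-+; m%n%n≡m%n; [m+n]%n≡m%n; [m+kn]%n≡m%n; m*n%n≡0; n%n≡0; m%n<n; m%n≤n; m<n⇒m%n≡m)
open import Algebra.Properties.CommutativeSemigroup +-commutativeSemigroup using (x∙yz≈y∙xz)
open import Data.Bool using (true; false)
open import Data.Bool.Properties using (T-≡; ¬-not; ∧-zeroʳ)
open import Data.Product using (_×_; ∃; _,_; proj₁; proj₂)
open import Data.Sum using (_⊎_; inj₁; inj₂)
open import Data.Empty using (⊥-elim)
import Data.Empty.Irrelevant as Irrelevant
open import Data.List using (List; []; _∷_; map)
open import Data.List.Relation.Unary.All as All using (All; []; _∷_)
import Data.List.Relation.Unary.All.Properties as All
open import Data.List.Relation.Unary.AllPairs as AllPairs using (AllPairs)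
import Data.List.Relation.Unary.AllPairs.Properties as AllPairs
open import Data.List.Relation.Binary.Pointwise using (Pointwise; []; _∷_)
import Data.List.Relation.Binary.Pointwise.Properties as Pointwise
open import Function.Bundles using (Equivalence)
open import Relation.Binary.Definitions using (tri<; tri≈; tri>)
open import Relation.Nullary using (yes; no)
open import Relation.Binary.PropositionalEquality

<ᵇ-true : ∀ {m n} → m < n → (m <ᵇ n) ≡ true
<ᵇ-true m<n = Equivalence.to T-≡ (<⇒<ᵇ m<n)

<ᵇ-false : ∀ {m n} → n ≤ m → (m <ᵇ n) ≡ false
<ᵇ-false {m} {n} n≤m = ¬-not (λ m<ᵇn → ≤⇒≯ n≤m (<ᵇ⇒< m n (Equivalence.from T-≡ m<ᵇn)))

≡ᵇ-true : ∀ {m n} → m ≡ n → (m ≡ᵇ n) ≡ true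
≡ᵇ-true {m} {n} m≡n = Equivalence.to T-≡ (≡⇒≡ᵇ m n m≡n)

triple-≡ : ∀ {x y} → h x ≡ h y → t x ≡ t y → k x ≡ k y → x ≡ y
triple-≡ refl refl refl = refl

t≤s : ∀ w → t w ≤ s w
t≤s w = m≤n+m (t w) (h w)

module Analysis (N K′ : ℕ) where

  K : ℕ
  K = suc K′

  open Model N K public

  NK NK₁ : ℕ
  NK  = N * K
  NK₁ = N * (K + 1)

  NK₁≡NK+N : NK₁ ≡ NK + N
  NK₁≡NK+N = trans (*-distribˡ-+ N K 1) (cong (NK +_) (*-identityʳ N))

  NK≤NK₁ : NK ≤ NK₁
  NK≤NK₁ = ≤-trans (m≤m+n NK N) (≤-reflexive (sym NK₁≡NK+N))

  ≼⇒s≥ : ∀ {a x} → a ≼ x → s x ≤ s a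
  ≼⇒s≥ (ta≡tx , hx≤ha) = +-mono-≤ hx≤ha (≤-reflexive (sym ta≡tx))

  -- Arithmetic modulo K and the representative function ∣_∣K.

  +-cong-% : ∀ a {b c} → b % K ≡ c % K → (a + b) % K ≡ (a + c) % K
  +-cong-% a {b} {c} b≡c = begin
    (a + b) % K          ≡⟨ %-distribˡ-+ a b K ⟩
    (a % K + b % K) % K  ≡⟨ cong (λ r → (a % K + r) % K) b≡c ⟩
    (a % K + c % K) % K  ≡⟨ sym (%-distribˡ-+ a c K) ⟩
    (a + c) % K          ∎
    where open ≡-Reasoning

  -- Subtracting one modulo K: K′ + (1 + a) = a + K.
  K′+suc-% : ∀ a → (K′ + suc a) % K ≡ a % K
  K′+suc-% a = trans (cong (_% K) (trans (+-suc K′ a) (+-comm K a))) ([m+n]%n≡m%n a K)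

  suc-cancel-% : ∀ {a b} → suc a % K ≡ suc b % K → a % K ≡ b % K
  suc-cancel-% {a} {b} e = trans (sym (K′+suc-% a)) (trans (+-cong-% K′ e) (K′+suc-% b))

  ∣∣K-unfold : ∀ n → ∣ n ∣K ≡ suc ((K′ + n) % K)
  ∣∣K-unfold n = cong (λ r → suc ((r ∸ 1) % K)) (+-comm n K)

  ∣∣K-% : ∀ n → ∣ n ∣K % K ≡ n % K
  ∣∣K-% n = begin
    ∣ n ∣K % K               ≡⟨ cong (_% K) (∣∣K-unfold n) ⟩
    (1 + (K′ + n) % K) % K   ≡⟨ +-cong-% 1 (m%n%n≡m%n (K′ + n) K) ⟩
    (K + n) % K              ≡⟨ cong (_% K) (+-comm K n) ⟩
    (n + K) % K              ≡⟨ [m+n]%n≡m%n n K ⟩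
    n % K                    ∎
    where open ≡-Reasoning

  ∣∣K-cong : ∀ u v → u % K ≡ v % K → ∣ u ∣K ≡ ∣ v ∣K
  ∣∣K-cong u v u≡v =
    trans (∣∣K-unfold u) (trans (cong suc (+-cong-% K′ u≡v)) (sym (∣∣K-unfold v)))

  ∣∣K-range : ∀ n → 1 ≤ ∣ n ∣K × ∣ n ∣K ≤ K
  ∣∣K-range n = s≤s z≤n , m%n<n (n + K ∸ 1) K

  ∣∣K-fixed : ∀ {κ} → 1 ≤ κ → κ ≤ K → ∣ κ ∣K ≡ κ
  ∣∣K-fixed {suc j} _ (s≤s j≤K′) =
    trans (∣∣K-unfold (suc j)) (cong suc (trans (K′+suc-% j) (m<n⇒m%n≡m (s≤s j≤K′))))

  ∣suc∣ : ∀ n → ∣ suc ∣ n ∣K ∣K ≡ ∣ suc n ∣K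
  ∣suc∣ n = ∣∣K-cong (suc ∣ n ∣K) (suc n) (+-cong-% 1 (∣∣K-% n))

  ∣NK+∣ : ∀ c → ∣ NK + c ∣K ≡ ∣ c ∣K
  ∣NK+∣ c = ∣∣K-cong (NK + c) c (trans (cong (_% K) (+-comm NK c)) ([m+kn]%n≡m%n c N K))

  shift-to : ∀ u {κ} → 1 ≤ κ → κ ≤ K → ∃ λ j → ∣ j + u ∣K ≡ κ
  shift-to u {κ} 1≤κ κ≤K = κ + u * K ∸ u , (begin
    ∣ κ + u * K ∸ u + u ∣K  ≡⟨ cong ∣_∣K (m∸n+n≡m (≤-trans (m≤m*n u K) (m≤n+m (u * K) κ))) ⟩
    ∣ κ + u * K ∣K          ≡⟨ ∣∣K-cong (κ + u * K) κ ([m+kn]%n≡m%n κ u K) ⟩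
    ∣ κ ∣K                  ≡⟨ ∣∣K-fixed 1≤κ κ≤K ⟩
    κ                       ∎)
    where open ≡-Reasoning

  raise : ℕ → ℕ → ℕ
  raise u v = u + (v + K′ * u) % K

  raise-≤ : ∀ u v → raise u v ≤ u + K
  raise-≤ u v = +-monoʳ-≤ u (m%n≤n (v + K′ * u) K)

  raise-% : ∀ u v → raise u v % K ≡ v % K
  raise-% u v = begin
    (u + (v + K′ * u) % K) % K  ≡⟨ +-cong-% u (m%n%n≡m%n (v + K′ * u) K) ⟩
    (u + (v + K′ * u)) % K      ≡⟨ cong (_% K) (x∙yz≈y∙xz u v (K′ * u)) ⟩
    (v + (u + K′ * u)) % K      ≡⟨ cong (λ r → (v + (u + r)) % K) (*-comm K′ u) ⟩
    (v + (u + u * K′)) % K      ≡⟨ cong (λ r → (v + r) % K) (sym (*-suc u K′)) ⟩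
    (v + u * K) % K             ≡⟨ [m+kn]%n≡m%n v u K ⟩
    v % K                       ∎
    where open ≡-Reasoning

  nonzero-residue : ∀ {κ} → 1 ≤ κ → κ ≤ K → κ ≢ K → κ % K ≢ 0
  nonzero-residue 1≤κ κ≤K κ≢K κ%K≡0 =
    <⇒≱ 1≤κ (≤-reflexive (trans (sym (m<n⇒m%n≡m (≤∧≢⇒< κ≤K κ≢K))) κ%K≡0))

  -- The triangle condition only involves the sum σ and the atom κ.
  TriangleAt : ℕ → ℕ → Set
  TriangleAt σ κ = σ ≤ NK × 1 ≤ κ × κ ≤ K × κ % K ≢ σ % K

  Triangle : Triple → Set
  Triangle w = TriangleAt (s w) (k w)

  triangle-transfer : ∀ {σ σ′ κ κ′} → σ ≡ σ′ → κ ≡ κ′ → TriangleAt σ κ → TriangleAt σ′ κ′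
  triangle-transfer refl refl T = T

  triangle-rise : ∀ {σ κ} → TriangleAt σ κ → σ < NK → TriangleAt (suc σ) ∣ suc κ ∣K
  triangle-rise {κ = κ} (_ , _ , _ , κ≢σ) σ<NK =
    σ<NK , proj₁ (∣∣K-range (suc κ)) , proj₂ (∣∣K-range (suc κ)) ,
    λ e → κ≢σ (suc-cancel-% (trans (sym (∣∣K-% (suc κ))) e))

  atom-range : ∀ {w} → In w → 1 ≤ k w × k w ≤ K
  atom-range (inj₁ (_ , 1≤k , k≤K , _)) = 1≤k , k≤K
  atom-range (inj₂ (_ , _ , _ , 1≤k , k≤K , _)) = 1≤k , k≤K

  above-apex-flat : ∀ {w} → In w → NK < s w → h w ≡ 0
  above-apex-flat (inj₁ (s≤NK , _)) NK<s = ⊥-elim (<⇒≱ NK<s s≤NK)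
  above-apex-flat (inj₂ (h≡0 , _)) _ = h≡0

  determined-above-apex : ∀ {x y} → In x → In y → NK < s x → s x ≡ s y → k x ≡ k y → x ≡ y
  determined-above-apex {x} {y} x∈ y∈ NK<sx s≡ k≡ = triple-≡ (trans hx≡0 (sym hy≡0)) t≡ k≡
    where
      hx≡0 = above-apex-flat x∈ NK<sx
      hy≡0 = above-apex-flat y∈ (<-≤-trans NK<sx (≤-reflexive s≡))
      t≡ : t x ≡ t y
      t≡ = trans (cong (_+ t x) (sym hx≡0)) (trans s≡ (cong (_+ t y) hy≡0))

  above-apex : ∀ {w} → In w → NK ≤ s w → k w % K ≢ 0
  above-apex (inj₁ (s≤NK , _ , _ , k≢s)) NK≤s k%K≡0 =
    k≢s (trans k%K≡0 (sym (trans (cong (_% K) (≤-antisym s≤NK NK≤s)) (m*n%n≡0 N K))))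
  above-apex (inj₂ (_ , _ , _ , 1≤k , k≤K , k≢K)) _ = nonzero-residue 1≤k k≤K k≢K

  tail-point : ∀ {t κ} → NK < t → t ≤ NK₁ → 1 ≤ κ × κ ≤ K → κ % K ≢ 0 → In ⟨ 0 , t , κ ⟩
  tail-point NK<t t≤NK₁ (1≤κ , κ≤K) κ≢0 =
    inj₂ (refl , NK<t , t≤NK₁ , 1≤κ , κ≤K , λ κ≡K → κ≢0 (trans (cong (_% K) κ≡K) (n%n≡0 K)))

  recolour : ∀ {y κ} → In y → NK ≤ s y → 1 ≤ κ × κ ≤ K → κ % K ≢ 0 → In ⟨ h y , t y , κ ⟩
  recolour (inj₁ (sy≤NK , _)) NK≤sy (1≤κ , κ≤K) κ≢0 =
    inj₁ (sy≤NK , 1≤κ , κ≤K , λ e → κ≢0 (trans e (trans (cong (_% K) (≤-antisym sy≤NK NK≤sy)) (m*n%n≡0 N K))))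
  recolour (inj₂ (refl , NK<t , t≤NK₁ , _)) _ κ-range κ≢0 = tail-point NK<t t≤NK₁ κ-range κ≢0

  f-rise : ∀ {h t κ} → h + t < NK → f ⟨ h , t , κ ⟩ ≡ ⟨ h , suc t , ∣ suc κ ∣K ⟩
  f-rise h+t<NK rewrite <ᵇ-true h+t<NK = refl

  f-descend : ∀ {h t κ} → suc h + t ≡ NK → f ⟨ suc h , t , κ ⟩ ≡ ⟨ h , suc t , κ ⟩
  f-descend on-apex rewrite <ᵇ-false (≤-reflexive (sym on-apex)) | ≡ᵇ-true on-apex = refl

  f-plateau : ∀ {t κ} → NK ≤ t → t < NK₁ → f ⟨ 0 , t , κ ⟩ ≡ ⟨ 0 , suc t , κ ⟩
  f-plateau {t} NK≤t t<NK₁ rewrite <ᵇ-false NK≤t | ∧-zeroʳ (t ≡ᵇ NK) | <ᵇ-true t<NK₁ = refl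

  f-wrap : ∀ {t κ} → NK ≤ t → NK₁ ≤ t → f ⟨ 0 , t , κ ⟩ ≡ ⟨ 0 , 0 , ∣ suc κ ∣K ⟩
  f-wrap {t} NK≤t NK₁≤t rewrite <ᵇ-false NK≤t | ∧-zeroʳ (t ≡ᵇ NK) | <ᵇ-false NK₁≤t = refl

  step-low : ∀ {w} → In w → s w < NK → In (f w) × s (f w) ≡ suc (s w) × k (f w) ≡ ∣ suc (k w) ∣K
  step-low {⟨ h , t , κ ⟩} (inj₁ T) s<NK =
    subst (λ v → In v × s v ≡ suc (h + t) × k v ≡ ∣ suc κ ∣K) (sym (f-rise s<NK))
      (inj₁ (triangle-transfer (sym (+-suc h t)) refl (triangle-rise T s<NK)) , +-suc h t , refl)
  step-low {w} (inj₂ (_ , NK<t , _)) s<NK = ⊥-elim (<⇒≱ NK<t (≤-trans (t≤s w) (<⇒≤ s<NK)))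

  step-high : ∀ {w} → In w → NK ≤ s w → s w < NK₁ →
              In (f w) × k (f w) ≡ k w × NK ≤ s (f w) × s (f w) ≤ suc (s w)
  step-high {⟨ suc h , t , κ ⟩} (inj₁ T@(s≤NK , _)) NK≤s _ =
    subst (λ v → In v × k v ≡ κ × NK ≤ s v × s v ≤ suc (suc h + t)) (sym (f-descend on-apex))
      ( inj₁ (triangle-transfer (sym (+-suc h t)) refl T)
      , refl , ≤-reflexive (sym (trans (+-suc h t) on-apex)) , ≤-trans (≤-reflexive (+-suc h t)) (n≤1+n _))
    where on-apex = ≤-antisym s≤NK NK≤s
  step-high {⟨ zero , t , κ ⟩} w∈ NK≤t t<NK₁ =
    subst (λ v → In v × k v ≡ κ × NK ≤ s v × s v ≤ suc t) (sym (f-plateau NK≤t t<NK₁))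
      (tail-point (s≤s NK≤t) t<NK₁ (atom-range w∈) (above-apex w∈ NK≤t)
      , refl , ≤-trans NK≤t (n≤1+n t) , ≤-refl)
  step-high {⟨ suc h , t , κ ⟩} (inj₂ (() , _)) _ _

  -- Reachability along orbits of f.

  Reach : Triple → Triple → Set
  Reach w v = ∃ λ n → iter f n w ≡ v

  iter-+ : ∀ a b w → iter f (a + b) w ≡ iter f a (iter f b w)
  iter-+ zero b w = refl
  iter-+ (suc a) b w = cong f (iter-+ a b w)

  reach-refl : ∀ {w} → Reach w w
  reach-refl = 0 , refl

  reach-step : ∀ {w v} → f w ≡ v → Reach w v
  reach-step fw≡v = 1 , fw≡v

  reach-trans : ∀ {u v w} → Reach u v → Reach v w → Reach u w
  reach-trans {u} (n₁ , e₁) (n₂ , e₂) = n₂ + n₁ , trans (iter-+ n₂ n₁ u) (trans (cong (iter f n₂) e₁) e₂)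

  rise : ∀ {h t} c d → h + (d + t) ≤ NK → Reach ⟨ h , t , ∣ c ∣K ⟩ ⟨ h , d + t , ∣ d + c ∣K ⟩
  rise c zero _ = reach-refl
  rise {h} {t} c (suc d) bound =
    reach-trans (rise c d (<⇒≤ below))
      (reach-step (trans (f-rise below) (cong (λ κ → ⟨ h , suc (d + t) , κ ⟩) (∣suc∣ (d + c)))))
    where
      below : h + (d + t) < NK
      below = ≤-trans (≤-reflexive (sym (+-suc h (d + t)))) bound

  descend : ∀ h {t κ} → h + t ≡ NK → Reach ⟨ h , t , κ ⟩ ⟨ 0 , h + t , κ ⟩
  descend zero _ = reach-refl
  descend (suc h) {t} {κ} on-apex =
    reach-trans (reach-step (f-descend on-apex))
      (subst (λ τ → Reach ⟨ h , suc t , κ ⟩ ⟨ 0 , τ , κ ⟩) (+-suc h t)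
        (descend h (trans (+-suc h t) on-apex)))

  plateau : ∀ {t κ} i → NK ≤ t → i + t ≤ NK₁ → Reach ⟨ 0 , t , κ ⟩ ⟨ 0 , i + t , κ ⟩
  plateau zero _ _ = reach-refl
  plateau {t} (suc i) NK≤t bound =
    reach-trans (plateau i NK≤t (<⇒≤ bound)) (reach-step (f-plateau (≤-trans NK≤t (m≤n+m t i)) bound))

  wrap-to-base : ∀ {t κ} → NK ≤ t → t ≤ NK₁ → Reach ⟨ 0 , t , κ ⟩ ⟨ 0 , 0 , ∣ suc κ ∣K ⟩
  wrap-to-base {t} {κ} NK≤t t≤NK₁ =
    reach-trans (subst (λ τ → Reach ⟨ 0 , t , κ ⟩ ⟨ 0 , τ , κ ⟩) top (plateau (NK₁ ∸ t) NK≤t (≤-reflexive top)))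
      (reach-step (f-wrap NK≤NK₁ ≤-refl))
    where top = m∸n+n≡m t≤NK₁

  lap : ∀ c → Reach ⟨ 0 , 0 , ∣ c ∣K ⟩ ⟨ 0 , 0 , ∣ suc c ∣K ⟩
  lap c =
    subst (λ κ → Reach ⟨ 0 , 0 , ∣ c ∣K ⟩ ⟨ 0 , 0 , κ ⟩) (trans (cong (λ κ → ∣ suc κ ∣K) (∣NK+∣ c)) (∣suc∣ c))
      (reach-trans (rise c NK (≤-reflexive (+-identityʳ NK)))
        (wrap-to-base (≤-reflexive (sym (+-identityʳ NK))) (≤-trans (≤-reflexive (+-identityʳ NK)) NK≤NK₁)))

  laps : ∀ c j → Reach ⟨ 0 , 0 , ∣ c ∣K ⟩ ⟨ 0 , 0 , ∣ j + c ∣K ⟩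
  laps c zero = reach-refl
  laps c (suc j) = reach-trans (laps c j) (lap (j + c))

  Spine : Triple → Set
  Spine w = h w ≡ 0 × t w ≤ NK₁ × 1 ≤ k w × k w ≤ K

  from-base-low : ∀ c {τ κ} → τ ≤ NK → 1 ≤ κ → κ ≤ K → Reach ⟨ 0 , 0 , ∣ c ∣K ⟩ ⟨ 0 , τ , κ ⟩
  from-base-low c {τ} {κ} τ≤NK 1≤κ κ≤K =
    let (j , ∣j+τ+c∣≡κ) = shift-to (τ + c) 1≤κ κ≤K in
    reach-trans (laps c j)
      (subst₂ (λ τ′ κ′ → Reach ⟨ 0 , 0 , ∣ j + c ∣K ⟩ ⟨ 0 , τ′ , κ′ ⟩) (+-identityʳ τ)
        (trans (cong ∣_∣K (x∙yz≈y∙xz τ j c)) ∣j+τ+c∣≡κ)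
        (rise (j + c) τ (≤-trans (≤-reflexive (+-identityʳ τ)) τ≤NK)))

  from-base : ∀ c {z} → Spine z → Reach ⟨ 0 , 0 , ∣ c ∣K ⟩ z
  from-base c {⟨ .0 , t , κ ⟩} (refl , t≤NK₁ , 1≤κ , κ≤K) with t ≤? NK
  ... | yes t≤NK = from-base-low c t≤NK 1≤κ κ≤K
  ... | no t≰NK =
    reach-trans (from-base-low c ≤-refl 1≤κ κ≤K)
      (subst (λ τ → Reach ⟨ 0 , NK , κ ⟩ ⟨ 0 , τ , κ ⟩) (m∸n+n≡m NK≤t)
        (plateau (t ∸ NK) ≤-refl (≤-trans (≤-reflexive (m∸n+n≡m NK≤t)) t≤NK₁)))
    where NK≤t = <⇒≤ (≰⇒> t≰NK)

  spine-to-base : ∀ {w} → Spine w → ∃ λ c → Reach w ⟨ 0 , 0 , ∣ c ∣K ⟩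
  spine-to-base {⟨ .0 , t , κ ⟩} (refl , t≤NK₁ , 1≤κ , κ≤K) with t ≤? NK
  ... | yes t≤NK = suc ∣ NK ∸ t + κ ∣K ,
    subst (λ κ′ → Reach ⟨ 0 , t , κ′ ⟩ ⟨ 0 , 0 , ∣ suc ∣ NK ∸ t + κ ∣K ∣K ⟩) (∣∣K-fixed 1≤κ κ≤K)
      (reach-trans (rise κ (NK ∸ t) (≤-reflexive apex))
        (subst (λ τ → Reach ⟨ 0 , τ , ∣ NK ∸ t + κ ∣K ⟩ ⟨ 0 , 0 , ∣ suc ∣ NK ∸ t + κ ∣K ∣K ⟩) (sym apex) (wrap-to-base ≤-refl NK≤NK₁)))
    where apex = m∸n+n≡m t≤NK
  ... | no t≰NK = suc κ , wrap-to-base (<⇒≤ (≰⇒> t≰NK)) t≤NK₁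

  triangle-to-spine : ∀ {w} → Triangle w → ∃ λ z → Spine z × Reach w z
  triangle-to-spine {⟨ h , t , κ ⟩} (s≤NK , 1≤κ , κ≤K , _) =
    let d = NK ∸ (h + t)
        on-apex : h + (d + t) ≡ NK
        on-apex = trans (x∙yz≈y∙xz h d t) (m∸n+n≡m s≤NK)
    in ⟨ 0 , h + (d + t) , ∣ d + κ ∣K ⟩
     , (refl , ≤-trans (≤-reflexive on-apex) NK≤NK₁ , ∣∣K-range (d + κ))
     , subst (λ κ′ → Reach ⟨ h , t , κ′ ⟩ ⟨ 0 , h + (d + t) , ∣ d + κ ∣K ⟩) (∣∣K-fixed 1≤κ κ≤K)
         (reach-trans (rise κ d (≤-reflexive on-apex)) (descend h on-apex))

  OrbitRegion : Triple → Set
  OrbitRegion w = Spine w ⊎ Triangle w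

  In⇒OrbitRegion : ∀ {w} → In w → OrbitRegion w
  In⇒OrbitRegion (inj₁ T) = inj₂ T
  In⇒OrbitRegion (inj₂ (h≡0 , _ , t≤NK₁ , 1≤k , k≤K , _)) = inj₁ (h≡0 , t≤NK₁ , 1≤k , k≤K)

  spine-step : ∀ {w} → Spine w → Spine (f w)
  spine-step {⟨ .0 , t , κ ⟩} (refl , t≤NK₁ , 1≤κ , κ≤K) with t <? NK | t <? NK₁
  ... | yes t<NK | _ = subst Spine (sym (f-rise t<NK)) (refl , ≤-trans t<NK NK≤NK₁ , ∣∣K-range (suc κ))
  ... | no t≮NK | yes t<NK₁ = subst Spine (sym (f-plateau (≮⇒≥ t≮NK) t<NK₁)) (refl , t<NK₁ , 1≤κ , κ≤K)
  ... | no t≮NK | no t≮NK₁ =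
    subst Spine (sym (f-wrap (≮⇒≥ t≮NK) (≮⇒≥ t≮NK₁))) (refl , z≤n , ∣∣K-range (suc κ))

  apex-step : ∀ {w} → Triangle w → s w ≡ NK → OrbitRegion (f w)
  apex-step {⟨ zero , t , κ ⟩} (s≤NK , 1≤κ , κ≤K , _) _ = inj₁ (spine-step (refl , ≤-trans s≤NK NK≤NK₁ , 1≤κ , κ≤K))
  apex-step {⟨ suc h , t , κ ⟩} T on-apex =
    subst OrbitRegion (sym (f-descend on-apex)) (inj₂ (triangle-transfer (sym (+-suc h t)) refl T))

  orbit-step : ∀ {w} → OrbitRegion w → OrbitRegion (f w)
  orbit-step (inj₁ S) = inj₁ (spine-step S)
  orbit-step {⟨ h , t , κ ⟩} (inj₂ T@(s≤NK , _)) with h + t <? NK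
  ... | yes s<NK =
    subst OrbitRegion (sym (f-rise s<NK)) (inj₂ (triangle-transfer (sym (+-suc h t)) refl (triangle-rise T s<NK)))
  ... | no s≮NK = apex-step T (≤-antisym s≤NK (≮⇒≥ s≮NK))

  orbit-iter : ∀ n {w} → OrbitRegion w → OrbitRegion (iter f n w)
  orbit-iter zero R = R
  orbit-iter (suc n) R = orbit-step (orbit-iter n R)

  reach-spine : ∀ {w z} → OrbitRegion w → Spine z → Reach w z
  reach-spine (inj₁ S) z-spine = let (c , to0) = spine-to-base S in reach-trans to0 (from-base c z-spine)
  reach-spine (inj₂ T) z-spine =
    let (v , v-spine , to-v) = triangle-to-spine T in reach-trans to-v (reach-spine (inj₁ v-spine) z-spine)

  -- The statement being proved, at level m; the bisimulation clauses below take it as the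
  -- induction hypothesis.
  Sim⊆Bisim : ℕ → Set
  Sim⊆Bisim m = ∀ u v → In u → In v → Sim m u v → Bisim m u v

  Forth≼ : ℕ → Triple → Triple → Set
  Forth≼ m a b = (as : List Triple) → All In as → AllPairs _≈_ as → All (_≼ a) as →
    ∃ λ (bs : List Triple) → All In bs × AllPairs _≈_ bs × All (_≼ b) bs × Pointwise (Bisim m) as bs

  sim-sym : ∀ {m x y} → Sim m x y → Sim m y x
  sim-sym (k≡ , inj₁ s≡) = sym k≡ , inj₁ (sym s≡)
  sim-sym (k≡ , inj₂ (inj₁ (x-low , y-low))) = sym k≡ , inj₂ (inj₁ (y-low , x-low))
  sim-sym (k≡ , inj₂ (inj₂ (x-high , y-high))) = sym k≡ , inj₂ (inj₂ (y-high , x-high))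

  bisim-refl : ∀ m w → Bisim m w w
  bisim-refl zero w = refl
  bisim-refl (suc m) w = refl , forth , forth , bisim-refl m (f w) , same-orbit , same-orbit
    where
      forth : Forth≼ m w w
      forth as as∈ cluster as≼w = as , as∈ , cluster , as≼w , Pointwise.refl (λ {a} → bisim-refl m a)
      same-orbit : ∀ n → ∃ λ n′ → Bisim m (iter f n w) (iter f n′ w)
      same-orbit n = n , bisim-refl m (iter f n w)

  lift : (ℕ → ℕ) → Triple → Triple → Triple
  lift G y a = ⟨ G (s a) , t y , k a ⟩

  ImageBelow : ℕ → Triple → Triple → Triple → Set
  ImageBelow m y a b = In b × b ≼ y × Sim m a b

  record Matching (m : ℕ) (x y : Triple) : Set where
    constructor matching-by
    field
      height  : ℕ → ℕ
      matches : ∀ a → In a → a ≼ x → ImageBelow m y a (lift height y a)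

  -- Lifting preserves clusters (it depends on a only through s a and k a), so a matching
  -- carries every cluster below x to one below y.
  matching⇒forth : ∀ {m x y} → Sim⊆Bisim m → Matching m x y → Forth≼ m x y
  matching⇒forth {m} {x} {y} IH (matching-by G match) as as∈ cluster as≼x =
    map g as ,
    All.map⁺ (All.zipWith (λ (a∈ , a≼x) → proj₁ (match _ a∈ a≼x)) (as∈ , as≼x)) ,
    AllPairs.map⁺ (AllPairs.map (λ {a} {b} → lift-≈ {a} {b}) cluster) ,
    All.map⁺ (All.zipWith (λ (a∈ , a≼x) → proj₁ (proj₂ (match _ a∈ a≼x))) (as∈ , as≼x)) ,
    related as∈ as≼x
    where
      g = lift G y
      lift-≈ : ∀ {a b} → a ≈ b → g a ≈ g b
      lift-≈ ((ta≡tb , hb≤ha) , (_ , ha≤hb)) =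
        (refl , ≤-reflexive (cong G (sym s≡))) , (refl , ≤-reflexive (cong G s≡))
        where s≡ = cong₂ _+_ (≤-antisym ha≤hb hb≤ha) ta≡tb
      related : ∀ {cs} → All In cs → All (_≼ x) cs → Pointwise (Bisim m) cs (map g cs)
      related [] [] = []
      related (c∈ ∷ cs∈) (c≼x ∷ cs≼x) =
        let (gc∈ , _ , c∼gc) = match _ c∈ c≼x in IH _ _ c∈ gc∈ c∼gc ∷ related cs∈ cs≼x

  at-sum : ∀ {y} σ κ → s y ≤ σ → s ⟨ σ ∸ t y , t y , κ ⟩ ≡ σ × ⟨ σ ∸ t y , t y , κ ⟩ ≼ y
  at-sum {y} σ κ sy≤σ = m∸n+n≡m (≤-trans (t≤s y) sy≤σ) , refl , m+n≤o⇒m≤o∸n (h y) sy≤σ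

  -- Clause (i) of ∼^{m+1}, equal sums: keep the sum of a.
  match-equal : ∀ {m x y} → In y → s x ≡ s y → Matching m x y
  match-equal {m} {x} {y} y∈ sx≡sy = matching-by (λ σ → σ ∸ t y) counterpart
    where
      counterpart : ∀ a → In a → a ≼ x → ImageBelow m y a (lift (λ σ → σ ∸ t y) y a)
      counterpart a a∈ a≼x = member a∈ , b≼y , refl , inj₁ (sym s≡)
        where
          sy≤sa = ≤-trans (≤-reflexive (sym sx≡sy)) (≼⇒s≥ {a} {x} a≼x)
          s≡ = proj₁ (at-sum {y} (s a) (k a) sy≤sa)
          b≼y = proj₂ (at-sum {y} (s a) (k a) sy≤sa)
          -- a tail point below x coincides with its lift
          member : In a → In ⟨ s a ∸ t y , t y , k a ⟩
          member (inj₁ T) = inj₁ (triangle-transfer (sym s≡) refl T)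
          member (inj₂ tail@(ha≡0 , NK<ta , _)) =
            subst In (sym (triple-≡ (trans (cong (s a ∸_) ty≡ta) (m+n∸n≡m (h a) (t a))) ty≡ta refl)) (inj₂ tail)
            where
              hx≡0 = n≤0⇒n≡0 (≤-trans (proj₂ a≼x) (≤-reflexive ha≡0))
              sy≡ta : s y ≡ t a
              sy≡ta = trans (sym sx≡sy) (trans (cong (_+ t x) hx≡0) (sym (proj₁ a≼x)))
              hy≡0 = above-apex-flat y∈ (≤-trans NK<ta (≤-reflexive (sym sy≡ta)))
              ty≡ta = trans (cong (_+ t y) (sym hy≡0)) sy≡ta

  -- The height used for low sums: copy the sum of a when it is at least s y, otherwise
  -- raise it to a sum in [s y, s y + K] with the same residue.
  low-height : Triple → ℕ → ℕ
  low-height y σ with s y ≤? σ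
  ... | yes _ = σ ∸ t y
  ... | no _ = raise (s y) σ ∸ t y

  module _ {m : ℕ} (m<N : m < N) where

    level-unfold : K * (N ∸ m) ≡ K + K * (N ∸ suc m)
    level-unfold = trans (cong (K *_) (+-∸-assoc 1 m<N)) (*-suc K (N ∸ suc m))

    low-bump : ∀ {q} → q ≤ K * (N ∸ suc m) → suc q ≤ K * (N ∸ m)
    low-bump q≤ = ≤-trans (+-mono-≤ (s≤s (z≤n {K′})) q≤) (≤-reflexive (sym level-unfold))

    level-≤-apex : K * (N ∸ m) ≤ NK
    level-≤-apex = ≤-trans (*-monoʳ-≤ K (m∸n≤m N m)) (≤-reflexive (*-comm K N))

    low-below-apex : K * (N ∸ suc m) < NK
    low-below-apex = ≤-trans (low-bump ≤-refl) level-≤-apex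

    tail-bump : ∀ {q} → q ≤ NK₁ ∸ suc m → suc q ≤ NK₁ ∸ m
    tail-bump q≤ = ≤-trans (s≤s q≤) (≤-reflexive (sym (+-∸-assoc 1 sm≤NK₁)))
      where sm≤NK₁ = ≤-trans m<N (≤-trans (m≤n+m N NK) (≤-reflexive (sym NK₁≡NK+N)))

    tail-shrink : NK₁ ∸ suc m ≤ NK₁ ∸ m
    tail-shrink = ∸-monoʳ-≤ NK₁ (n≤1+n m)

    apex-in-tail-range : NK ≤ NK₁ ∸ suc m
    apex-in-tail-range = m+n≤o⇒m≤o∸n NK (≤-trans (+-monoʳ-≤ NK m<N) (≤-reflexive (sym NK₁≡NK+N)))

    tail-below-top : NK₁ ∸ suc m < NK₁
    tail-below-top = ≤-trans (tail-bump ≤-refl) (m∸n≤m NK₁ m)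

    -- Clause (ii) of ∼^{m+1}, both sums at most K(N−m−1): points below x are triangle points.
    match-low : ∀ {x y} → s x ≤ K * (N ∸ suc m) → s y ≤ K * (N ∸ suc m) → Matching m x y
    match-low {x} {y} sx≤ sy≤ = matching-by (low-height y) counterpart
      where
        counterpart : ∀ a → In a → a ≼ x → ImageBelow m y a (lift (low-height y) y a)
        counterpart a (inj₂ (_ , NK<ta , _)) (ta≡tx , _) =
          ⊥-elim (<⇒≱ NK<ta (≤-trans (≤-reflexive ta≡tx) (≤-trans (t≤s x) (≤-trans sx≤ (<⇒≤ low-below-apex)))))
        counterpart a (inj₁ T) a≼x with s y ≤? s a
        ... | yes sy≤sa =
          let (s≡ , b≼y) = at-sum {y} (s a) (k a) sy≤sa in
          inj₁ (triangle-transfer (sym s≡) refl T) , b≼y , refl , inj₁ (sym s≡)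
        ... | no sy≰sa =
          let S = raise (s y) (s a)
              (s≡ , b≼y) = at-sum {y} S (k a) (m≤m+n (s y) _)
              S≤level = ≤-trans (raise-≤ (s y) (s a))
                          (≤-trans (+-monoˡ-≤ K sy≤) (≤-reflexive (trans (+-comm _ K) (sym level-unfold))))
              sa≤level = ≤-trans (<⇒≤ (≰⇒> sy≰sa)) (≤-trans sy≤ (<⇒≤ (low-bump ≤-refl)))
              (_ , 1≤k , k≤K , k≢sa) = T
          in inj₁ ( ≤-trans (≤-reflexive s≡) (≤-trans S≤level level-≤-apex)
                  , 1≤k , k≤K , λ e → k≢sa (trans e (trans (cong (_% K) s≡) (raise-% (s y) (s a)))))
           , b≼y , refl , inj₂ (inj₁ (sa≤level , ≤-trans (≤-reflexive s≡) S≤level))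

    -- Clause (iii) of ∼^{m+1}, both sums in [NK, NK₁−m−1]: give y the atom of a.
    match-tail : ∀ {x y} → In y → NK ≤ s x × s x ≤ NK₁ ∸ suc m → NK ≤ s y × s y ≤ NK₁ ∸ suc m → Matching m x y
    match-tail {x} {y} y∈ (NK≤sx , sx≤) (NK≤sy , sy≤) = matching-by (λ _ → h y) counterpart
      where
        counterpart : ∀ a → In a → a ≼ x → ImageBelow m y a ⟨ h y , t y , k a ⟩
        counterpart a a∈ a≼x =
          recolour y∈ NK≤sy (atom-range a∈) (above-apex a∈ NK≤sa) , (refl , ≤-refl) , refl ,
          inj₂ (inj₂ ((NK≤sa , sa≤ a∈) , (NK≤sy , ≤-trans sy≤ tail-shrink)))
          where
            NK≤sa = ≤-trans NK≤sx (≼⇒s≥ {a} {x} a≼x)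
            sa≤ : In a → s a ≤ NK₁ ∸ m
            sa≤ (inj₁ (sa≤NK , _)) = ≤-trans sa≤NK (≤-trans apex-in-tail-range tail-shrink)
            sa≤ (inj₂ (ha≡0 , _)) =
              ≤-trans (≤-reflexive (trans (cong (_+ t a) ha≡0) (proj₁ a≼x)))
                (≤-trans (t≤s x) (≤-trans sx≤ tail-shrink))

    matching : ∀ {x y} → In y → Sim (suc m) x y → Matching m x y
    matching y∈ (_ , inj₁ s≡) = match-equal y∈ s≡
    matching _ (_ , inj₂ (inj₁ (sx≤ , sy≤))) = match-low sx≤ sy≤
    matching y∈ (_ , inj₂ (inj₂ (x-range , y-range))) = match-tail y∈ x-range y-range

    StepRelated : Triple → Triple → Set
    StepRelated x y = f x ≡ f y ⊎ (In (f x) × In (f y) × Sim m (f x) (f y))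

    step-low-pair : ∀ {x y} → In x → In y → s x < NK → s y < NK → k x ≡ k y →
      In (f x) × In (f y) × k (f x) ≡ k (f y) × s (f x) ≡ suc (s x) × s (f y) ≡ suc (s y)
    step-low-pair x∈ y∈ sx<NK sy<NK k≡ =
      let (fx∈ , sfx≡ , kfx≡) = step-low x∈ sx<NK
          (fy∈ , sfy≡ , kfy≡) = step-low y∈ sy<NK
      in fx∈ , fy∈ , trans kfx≡ (trans (cong (λ κ → ∣ suc κ ∣K) k≡) (sym kfy≡)) , sfx≡ , sfy≡

    step-tail-range : ∀ {x y} → In x → In y → k x ≡ k y →
      NK ≤ s x × s x ≤ NK₁ ∸ suc m → NK ≤ s y × s y ≤ NK₁ ∸ suc m → StepRelated x y
    step-tail-range x∈ y∈ k≡ (NK≤sx , sx≤) (NK≤sy , sy≤) =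
      let (fx∈ , kfx≡ , NK≤sfx , sfx≤) = step-high x∈ NK≤sx (≤-<-trans sx≤ tail-below-top)
          (fy∈ , kfy≡ , NK≤sfy , sfy≤) = step-high y∈ NK≤sy (≤-<-trans sy≤ tail-below-top)
      in inj₂ (fx∈ , fy∈ , trans kfx≡ (trans k≡ (sym kfy≡)) ,
               inj₂ (inj₂ ((NK≤sfx , ≤-trans sfx≤ (tail-bump sx≤)) , (NK≤sfy , ≤-trans sfy≤ (tail-bump sy≤)))))

    -- Clause (i): below the apex sums stay equal, on the apex level clause (iii) applies,
    -- and above the apex the two points coincide.
    step-same-sum : ∀ {x y} → In x → In y → s x ≡ s y → k x ≡ k y → StepRelated x y
    step-same-sum {x} {y} x∈ y∈ s≡ k≡ with <-cmp (s x) NK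
    ... | tri< sx<NK _ _ =
      let (fx∈ , fy∈ , kf≡ , sfx≡ , sfy≡) = step-low-pair x∈ y∈ sx<NK (subst (_< NK) s≡ sx<NK) k≡
      in inj₂ (fx∈ , fy∈ , kf≡ , inj₁ (trans sfx≡ (trans (cong suc s≡) (sym sfy≡))))
    ... | tri≈ _ sx≡NK _ =
      let on-apex = (≤-reflexive (sym sx≡NK) , ≤-trans (≤-reflexive sx≡NK) apex-in-tail-range)
      in step-tail-range x∈ y∈ k≡ on-apex (subst (λ σ → NK ≤ σ × σ ≤ NK₁ ∸ suc m) s≡ on-apex)
    ... | tri> _ _ NK<sx = inj₁ (cong f (determined-above-apex x∈ y∈ NK<sx s≡ k≡))

    step-sim : ∀ {x y} → In x → In y → Sim (suc m) x y → StepRelated x y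
    step-sim x∈ y∈ (k≡ , inj₁ s≡) = step-same-sum x∈ y∈ s≡ k≡
    step-sim x∈ y∈ (k≡ , inj₂ (inj₁ (sx≤ , sy≤))) =
      let (fx∈ , fy∈ , kf≡ , sfx≡ , sfy≡) =
            step-low-pair x∈ y∈ (≤-<-trans sx≤ low-below-apex) (≤-<-trans sy≤ low-below-apex) k≡
      in inj₂ (fx∈ , fy∈ , kf≡ ,
               inj₂ (inj₁ (≤-trans (≤-reflexive sfx≡) (low-bump sx≤) , ≤-trans (≤-reflexive sfy≡) (low-bump sy≤))))
    step-sim x∈ y∈ (k≡ , inj₂ (inj₂ (x-range , y-range))) = step-tail-range x∈ y∈ k≡ x-range y-range

    forth-f : ∀ {x y} → Sim⊆Bisim m → In x → In y → Sim (suc m) x y → Bisim m (f x) (f y)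
    forth-f {x} IH x∈ y∈ x∼y with step-sim x∈ y∈ x∼y
    ... | inj₁ fx≡fy = subst (Bisim m (f x)) fx≡fy (bisim-refl m (f x))
    ... | inj₂ (fx∈ , fy∈ , fx∼fy) = IH _ _ fx∈ fy∈ fx∼fy

  -- Forth_[f]: an orbit point on the spine is reached from y itself; one in the triangle is
  -- ∼^m-related to the spine point with the same sum and atom, which is reached from y.
  forth-iter : ∀ {m x y} → Sim⊆Bisim m → In x → In y → ∀ n → ∃ λ n′ → Bisim m (iter f n x) (iter f n′ y)
  forth-iter {m} {x} {y} IH x∈ y∈ n with iter f n x | orbit-iter n (In⇒OrbitRegion x∈)
  ... | w | inj₁ w-spine =
    let (n′ , y→w) = reach-spine (In⇒OrbitRegion y∈) w-spine
    in n′ , subst (Bisim m w) (sym y→w) (bisim-refl m w)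
  ... | w | inj₂ w-tri@(s≤NK , 1≤k , k≤K , _) =
    let (n′ , y→z) = reach-spine (In⇒OrbitRegion y∈) (refl , ≤-trans s≤NK NK≤NK₁ , 1≤k , k≤K)
    in n′ , subst (Bisim m w) (sym y→z) (IH w ⟨ 0 , s w , k w ⟩ (inj₁ w-tri) (inj₁ w-tri) (refl , inj₁ refl))

mainTheorem4 : (N K : ℕ) → .{{_ : NonZero K}} → (m : ℕ) → m < N →
    (x y : Triple) → Model.In N K x → Model.In N K y →
    Model.Sim N K m x y → Model.Bisim N K m x y
mainTheorem4 N zero {{K≢0}} _ _ _ _ _ _ _ = Irrelevant.⊥-elim (NonZero.nonZero K≢0)
mainTheorem4 N (suc K′) zero _ _ _ _ _ (same-atom , _) = same-atom
mainTheorem4 N (suc K′) (suc m) m+1<N x y x∈ y∈ x∼y =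
  proj₁ x∼y ,
  matching⇒forth IH (matching m<N {x} y∈ x∼y) ,
  matching⇒forth IH (matching m<N {y} x∈ (sim-sym {suc m} {x} {y} x∼y)) ,
  forth-f m<N IH x∈ y∈ x∼y ,
  forth-iter IH x∈ y∈ ,
  forth-iter IH y∈ x∈
  where
    open Analysis N K′
    m<N : m < N
    m<N = <⇒≤ m+1<N
    IH : Sim⊆Bisim m
    IH = mainTheorem4 N (suc K′) m m<N
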